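{- Let $p \geq 1$ be an integer. If $n$ is a positive integer that cannot be written as a sum of $p$ or fewer squares of positive integers, then $j(n) \equiv 0 \pmod{2^{p+1}}$.
   Context: A 01-partition (jagged partition) of a non-negative integer $n$ is a finite sequence $(n_1,\dots,n_m)$ of non-negative integers with $\sum_i n_i = n$, whose last entry satisfies $n_m \geq 1$, and such that $n_j \geq n_{j+1}-1$ and $n_j \geq n_{j+2}$ whenever the indices are in range. The empty sequence is the unique 01-partition of $0$. $j(n)$ denotes the number of 01-partitions of $n$. -}

module Defs where

open import Data.Nat using (ℕ; zero; suc; _+_; _*_; _≤_; _≥_; _∸_)
open import Data.Nat.ListAction using (sum)
open import Data.List using (List; []; _∷_; length; map)
open import Data.List.Relation.Unary.All using (All)
open import Data.Unit using (⊤)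
open import Data.Product using (Σ; _×_)
open import Relation.Binary.PropositionalEquality using (_≡_)

-- Local conditions of a 01-partition (n_1,...,n_m):
--   n_j ≥ n_{j+1} - 1  and  n_j ≥ n_{j+2}  whenever indices are in range
--   (truncated subtraction is harmless: n_j ≥ 0 anyway), and last entry n_m ≥ 1.
Jagged : List ℕ → Set
Jagged []                = ⊤
Jagged (x ∷ [])          = x ≥ 1
Jagged (x ∷ y ∷ [])      = (x ≥ y ∸ 1) × Jagged (y ∷ [])
Jagged (x ∷ y ∷ z ∷ xs)  = (x ≥ y ∸ 1) × (x ≥ z) × Jagged (y ∷ z ∷ xs)

Is01Partition : ℕ → List ℕ → Set
Is01Partition n xs = (sum xs ≡ n) × Jagged xs

SumOfAtMostSquares : ℕ → ℕ → Set
SumOfAtMostSquares p n =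
  Σ (List ℕ) λ xs → (length xs ≤ p) × All (λ x → x ≥ 1) xs × (sum (map (λ x → x * x) xs) ≡ n)

{-# OPTIONS --safe #-}
-- Let A_s (resp. B_s) be the generating function of the 01-partitions whose first two parts
-- are at most s, s (resp. s, s + 1). Removing a leading part s + 1, resp. leading parts s, s + 1,
-- gives (1 - q^{s+1}) A_{s+1} = B_s and (1 - q^{2s+1}) B_s = A_s, with A_0 = 1; so A_s is the
-- inverse of Q_s = (q; q)_s (q; q²)_s. By the finite Gauss identity
-- (q; q²)_s = ∑_{|k| ≤ s} (-1)^k q^{k²} [2s choose s+k]_q, Q_s agrees with
-- θ(-q) = ∑_{k ∈ ℤ} (-1)^k q^{k²} up to degree s, while A_s agrees with ∑ j(n) q^n up to degree s.
-- Hence θ(-q) ∑ j(n) q^n = 1, i.e. j(n) = -2 ∑_{k ≥ 1} (-1)^k j(n - k²) for n ≥ 1. If n is not a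
-- sum of at most p positive squares, each n - k² ≥ 0 is positive and not a sum of at most p - 1
-- of them, so by induction on p every term of that sum is divisible by 2^p.
module Submission where

open import Defs
open import Data.Nat using (ℕ; _≤_; _^_; _≥_)
open import Data.Nat.Divisibility using (_∣_)
open import Data.List using (List; length)
open import Data.List.Membership.Propositional using (_∈_)
open import Data.List.Relation.Unary.Unique.Propositional using (Unique)
open import Data.Product using (_×_)
open import Relation.Nullary using (¬_)

open import Data.Nat using (zero; suc; pred; _+_; _*_; _∸_; _<_; _≤?_; z≤n; s≤s)
import Data.Nat.Properties as ℕ
open import Data.Nat.Tactic.RingSolver using () renaming (solve-∀ to ℕ-solve)
open import Data.Integer using (ℤ; +_; 0ℤ; 1ℤ; -1ℤ)
  renaming (_+_ to _+ᶻ_; _-_ to _-ᶻ_; _*_ to _*ᶻ_; -_ to -ᶻ_; _^_ to _^ᶻ_)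
import Data.Integer.Properties as ℤ
open import Data.Integer.Tactic.RingSolver using () renaming (solve-∀ to ℤ-solve)
open import Data.Product using (_,_; proj₁; proj₂; ∃-syntax)
open import Data.Sum using (_⊎_; inj₁; inj₂)
open import Data.Unit using (⊤; tt)
open import Data.Empty using (⊥-elim)
open import Data.Nat.ListAction using (sum)
open import Data.Nat.Induction using (<-rec)
open import Data.List using ([]; _∷_; _++_; map; drop)
import Data.List.Properties as List
open import Data.List.Membership.Propositional.Properties
  using (∈-∃++; ∈-++⁻; ∈-++⁺ˡ; ∈-++⁺ʳ; ∈-map⁺; ∈-map⁻)
open import Data.List.Relation.Binary.Subset.Propositional using (_⊆_)
import Data.List.Relation.Unary.All as All
open import Data.List.Relation.Unary.Any using (here; there)
open import Data.List.Relation.Unary.Unique.Propositional using ([]; _∷_)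
import Data.List.Relation.Unary.Unique.Propositional.Properties as Unique
open import Function using (_∘_)
open import Data.Integer.Divisibility.Signed
  using (divides; ∣m∣n⇒∣m+n; ∣m⇒∣-m; ∣n⇒∣m*n; *-monoʳ-∣; ∣⇒∣ᵤ)
  renaming (_∣_ to _∣ᶻ_)
open import Function.Definitions using (Injective)
open import Level using (0ℓ)
open import Relation.Binary.Bundles using (Setoid)
import Relation.Binary.Reasoning.Setoid as SetoidReasoning
open import Relation.Binary.PropositionalEquality
  using (_≡_; refl; sym; trans; cong; cong₂; subst; module ≡-Reasoning)
open import Relation.Nullary using (yes; no)

-- Formal power series

Series : Set
Series = ℕ → ℤ

infix  4 _≈_
infixl 6 _⊕_ _⊖_
infixr 7 _•_ q^_·_ 1-q^_·_

record _≈_ (X Y : Series) : Set where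
  constructor coeffwise
  field coeff : ∀ n → X n ≡ Y n
open _≈_ public

≈-setoid : Setoid 0ℓ 0ℓ
≈-setoid = record
  { Carrier       = Series
  ; _≈_           = _≈_
  ; isEquivalence = record
    { refl  = coeffwise λ _ → refl
    ; sym   = λ X≈Y → coeffwise λ n → sym (coeff X≈Y n)
    ; trans = λ X≈Y Y≈Z → coeffwise λ n → trans (coeff X≈Y n) (coeff Y≈Z n)
    }
  }

open Setoid ≈-setoid public using () renaming (refl to ≈-refl; sym to ≈-sym; trans to ≈-trans)
module ≈-Reasoning = SetoidReasoning ≈-setoid

≡⇒≈ : ∀ {X Y} → X ≡ Y → X ≈ Y
≡⇒≈ refl = ≈-refl

zipWith : (ℤ → ℤ → ℤ) → Series → Series → Series
zipWith f X Y n = f (X n) (Y n)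

𝟘 𝟙 : Series
𝟘 _ = 0ℤ
𝟙 zero    = 1ℤ
𝟙 (suc _) = 0ℤ

_⊕_ _⊖_ : Series → Series → Series
_⊕_ = zipWith _+ᶻ_
_⊖_ = zipWith _-ᶻ_

_•_ : ℤ → Series → Series
(c • X) n = c *ᶻ X n

⊕-cong : ∀ {X X′ Y Y′} → X ≈ X′ → Y ≈ Y′ → X ⊕ Y ≈ X′ ⊕ Y′
⊕-cong X≈X′ Y≈Y′ = coeffwise λ n → cong₂ _+ᶻ_ (coeff X≈X′ n) (coeff Y≈Y′ n)

⊖-cong : ∀ {X X′ Y Y′} → X ≈ X′ → Y ≈ Y′ → X ⊖ Y ≈ X′ ⊖ Y′
⊖-cong X≈X′ Y≈Y′ = coeffwise λ n → cong₂ _-ᶻ_ (coeff X≈X′ n) (coeff Y≈Y′ n)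

⊕-congˡ : ∀ X {Y Y′} → Y ≈ Y′ → X ⊕ Y ≈ X ⊕ Y′
⊕-congˡ X = ⊕-cong {X} ≈-refl

⊕-congʳ : ∀ Y {X X′} → X ≈ X′ → X ⊕ Y ≈ X′ ⊕ Y
⊕-congʳ Y X≈X′ = ⊕-cong X≈X′ (≈-refl {Y})

⊕-comm : ∀ X Y → X ⊕ Y ≈ Y ⊕ X
⊕-comm X Y = coeffwise λ n → ℤ.+-comm (X n) (Y n)

⊖-congˡ : ∀ X {Y Y′} → Y ≈ Y′ → X ⊖ Y ≈ X ⊖ Y′
⊖-congˡ X = ⊖-cong {X} ≈-refl

•-cong : ∀ c {X Y} → X ≈ Y → c • X ≈ c • Y
•-cong c X≈Y = coeffwise λ n → cong (c *ᶻ_) (coeff X≈Y n)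

q^_·_ : ℕ → Series → Series
(q^ zero  · X) n       = X n
(q^ suc u · X) zero    = 0ℤ
(q^ suc u · X) (suc n) = (q^ u · X) n

1-q^_·_ : ℕ → Series → Series
(1-q^ u · X) n = X n -ᶻ (q^ u · X) n

q^-< : ∀ u X {n} → n < u → (q^ u · X) n ≡ 0ℤ
q^-< (suc u) X {zero}  _         = refl
q^-< (suc u) X {suc n} (s≤s n<u) = q^-< u X n<u

q^-≥ : ∀ u X {n} → u ≤ n → (q^ u · X) n ≡ X (n ∸ u)
q^-≥ zero    X         _         = refl
q^-≥ (suc u) X {suc n} (s≤s u≤n) = q^-≥ u X u≤n

q^-cong-at : ∀ u {X Y} n → (u ≤ n → X (n ∸ u) ≡ Y (n ∸ u)) → (q^ u · X) n ≡ (q^ u · Y) n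
q^-cong-at u {X} {Y} n eq with u ≤? n
... | yes u≤n = trans (q^-≥ u X u≤n) (trans (eq u≤n) (sym (q^-≥ u Y u≤n)))
... | no  u≰n = trans (q^-< u X (ℕ.≰⇒> u≰n)) (sym (q^-< u Y (ℕ.≰⇒> u≰n)))

q^-cong : ∀ u {X Y} → X ≈ Y → q^ u · X ≈ q^ u · Y
q^-cong u X≈Y = coeffwise λ n → q^-cong-at u n λ _ → coeff X≈Y (n ∸ u)

1-q^-cong : ∀ u {X Y} → X ≈ Y → 1-q^ u · X ≈ 1-q^ u · Y
1-q^-cong u X≈Y = ⊖-cong X≈Y (q^-cong u X≈Y)

q^-zipWith : ∀ f → f 0ℤ 0ℤ ≡ 0ℤ →
             ∀ u X Y → q^ u · zipWith f X Y ≈ zipWith f (q^ u · X) (q^ u · Y)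
q^-zipWith f f00 u X Y = coeffwise (go u)
  where
  go : ∀ u n → (q^ u · zipWith f X Y) n ≡ f ((q^ u · X) n) ((q^ u · Y) n)
  go zero    n       = refl
  go (suc u) zero    = sym f00
  go (suc u) (suc n) = go u n

q^-⊕ : ∀ u X Y → q^ u · (X ⊕ Y) ≈ q^ u · X ⊕ q^ u · Y
q^-⊕ = q^-zipWith _+ᶻ_ refl

q^-⊖ : ∀ u X Y → q^ u · (X ⊖ Y) ≈ q^ u · X ⊖ q^ u · Y
q^-⊖ = q^-zipWith _-ᶻ_ refl

q^-• : ∀ u c X → q^ u · c • X ≈ c • q^ u · X
q^-• u c X = coeffwise (go u)
  where
  go : ∀ u n → (q^ u · c • X) n ≡ c *ᶻ (q^ u · X) n
  go zero    n       = refl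
  go (suc u) zero    = sym (ℤ.*-zeroʳ c)
  go (suc u) (suc n) = go u n

q^-+ : ∀ u v X → q^ u · q^ v · X ≈ q^ (u + v) · X
q^-+ u v X = coeffwise (go u)
  where
  go : ∀ u n → (q^ u · q^ v · X) n ≡ (q^ (u + v) · X) n
  go zero    n       = refl
  go (suc u) zero    = refl
  go (suc u) (suc n) = go u n

q^-comm : ∀ u v X → q^ u · q^ v · X ≈ q^ v · q^ u · X
q^-comm u v X = begin
  q^ u · q^ v · X  ≈⟨ q^-+ u v X ⟩
  q^ (u + v) · X   ≡⟨ cong (q^_· X) (ℕ.+-comm u v) ⟩
  q^ (v + u) · X   ≈⟨ q^-+ v u X ⟨
  q^ v · q^ u · X  ∎
  where open ≈-Reasoning

1-q^-< : ∀ u X {n} → n < u → (1-q^ u · X) n ≡ X n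
1-q^-< u X {n} n<u = trans (cong (_-ᶻ_ (X n)) (q^-< u X n<u)) (ℤ.+-identityʳ (X n))

1-q^-+ : ∀ u v X → 1-q^ u · X ⊕ q^ u · 1-q^ v · X ≈ 1-q^ (u + v) · X
1-q^-+ u v X = begin
  1-q^ u · X ⊕ q^ u · 1-q^ v · X             ≈⟨ ⊕-congˡ (1-q^ u · X) (q^-⊖ u X (q^ v · X)) ⟩
  1-q^ u · X ⊕ (q^ u · X ⊖ q^ u · q^ v · X)  ≈⟨ coeffwise (λ n → telescope (X n) ((q^ u · X) n) _) ⟩
  X ⊖ q^ u · q^ v · X                        ≈⟨ ⊖-congˡ X (q^-+ u v X) ⟩
  1-q^ (u + v) · X                           ∎
  where
  open ≈-Reasoning
  telescope : ∀ a b c → (a -ᶻ b) +ᶻ (b -ᶻ c) ≡ a -ᶻ c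
  telescope = ℤ-solve

-- ∑ r F sums F k over 1 ≤ k ≤ r, and ∑± s F is ∑_{k = -s}^{s} F |k|.
∑ : ℕ → (ℕ → Series) → Series
∑ zero    F = 𝟘
∑ (suc r) F = ∑ r F ⊕ F (suc r)

∑± : ℕ → (ℕ → Series) → Series
∑± s F = F 0 ⊕ + 2 • ∑ s F

∑-cong-at : ∀ r {F G} n → (∀ {k} → 1 ≤ k → k ≤ r → F k n ≡ G k n) → ∑ r F n ≡ ∑ r G n
∑-cong-at zero    n eq = refl
∑-cong-at (suc r) n eq =
  cong₂ _+ᶻ_ (∑-cong-at r n λ 1≤k k≤r → eq 1≤k (ℕ.m≤n⇒m≤1+n k≤r)) (eq (s≤s z≤n) ℕ.≤-refl)

∑-cong : ∀ r {F G} → (∀ {k} → 1 ≤ k → k ≤ r → F k ≈ G k) → ∑ r F ≈ ∑ r G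
∑-cong r eq = coeffwise λ n → ∑-cong-at r n λ 1≤k k≤r → coeff (eq 1≤k k≤r) n

∑±-cong-at : ∀ s (F G : ℕ → Series) n →
             (∀ {k} → k ≤ s → F k n ≡ G k n) → ∑± s F n ≡ ∑± s G n
∑±-cong-at s F G n eq = cong₂ _+ᶻ_ (eq z≤n) (cong (+ 2 *ᶻ_) (∑-cong-at s n λ _ k≤s → eq k≤s))

∑-⊕ : ∀ r (F G : ℕ → Series) → ∑ r (λ k → F k ⊕ G k) ≈ ∑ r F ⊕ ∑ r G
∑-⊕ zero    F G = coeffwise λ _ → refl
∑-⊕ (suc r) F G = coeffwise λ n →
  trans (cong (_+ᶻ (F (suc r) n +ᶻ G (suc r) n)) (coeff (∑-⊕ r F G) n))
        (interchange (∑ r F n) (∑ r G n) (F (suc r) n) (G (suc r) n))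
  where
  interchange : ∀ a b c d → (a +ᶻ b) +ᶻ (c +ᶻ d) ≡ (a +ᶻ c) +ᶻ (b +ᶻ d)
  interchange = ℤ-solve

∑-telescope : ∀ r (C : ℕ → Series) → ∑ r (λ k → C k ⊖ C (pred k)) ≈ C r ⊖ C 0
∑-telescope zero    C = coeffwise λ n → sym (ℤ.+-inverseʳ (C 0 n))
∑-telescope (suc r) C = coeffwise λ n →
  trans (cong (_+ᶻ (C (suc r) n -ᶻ C r n)) (coeff (∑-telescope r C) n))
        (telescope (C r n) (C 0 n) (C (suc r) n))
  where
  telescope : ∀ a b c → (a -ᶻ b) +ᶻ (c -ᶻ a) ≡ c -ᶻ b
  telescope = ℤ-solve

-- 2 C 0 + 2 ∑_{k=1}^{s} (C k - C (k - 1)) - 2 C s = 0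
∑±-telescope : ∀ s (F F′ C : ℕ → Series) →
               F′ 0 ≈ F 0 ⊕ + 2 • C 0 →
               (∀ {k} → 1 ≤ k → k ≤ s → F′ k ≈ F k ⊕ (C k ⊖ C (pred k))) →
               F′ (suc s) ⊕ C s ≈ 𝟘 →
               ∑± (suc s) F′ ≈ ∑± s F
∑±-telescope s F F′ C first middle last = coeffwise λ n → begin
  F′ 0 n +ᶻ + 2 *ᶻ (∑ s F′ n +ᶻ F′ (suc s) n)
    ≡⟨ cong₂ (λ a b → a +ᶻ + 2 *ᶻ (b +ᶻ F′ (suc s) n)) (coeff first n) (coeff ∑-F′ n) ⟩
  (F 0 n +ᶻ + 2 *ᶻ C 0 n) +ᶻ + 2 *ᶻ ((∑ s F n +ᶻ (C s n -ᶻ C 0 n)) +ᶻ F′ (suc s) n)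
    ≡⟨ regroup (F 0 n) (C 0 n) (∑ s F n) (C s n) (F′ (suc s) n) ⟩
  (F 0 n +ᶻ + 2 *ᶻ ∑ s F n) +ᶻ + 2 *ᶻ (F′ (suc s) n +ᶻ C s n)
    ≡⟨ cong (λ e → (F 0 n +ᶻ + 2 *ᶻ ∑ s F n) +ᶻ + 2 *ᶻ e) (coeff last n) ⟩
  (F 0 n +ᶻ + 2 *ᶻ ∑ s F n) +ᶻ 0ℤ
    ≡⟨ ℤ.+-identityʳ _ ⟩
  F 0 n +ᶻ + 2 *ᶻ ∑ s F n ∎
  where
  open ≡-Reasoning
  ∑-F′ : ∑ s F′ ≈ ∑ s F ⊕ (C s ⊖ C 0)
  ∑-F′ = ≈-trans (∑-cong s middle)
                 (≈-trans (∑-⊕ s F (λ k → C k ⊖ C (pred k))) (⊕-congˡ (∑ s F) (∑-telescope s C)))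
  regroup : ∀ f c₀ σ cₛ e → (f +ᶻ + 2 *ᶻ c₀) +ᶻ + 2 *ᶻ ((σ +ᶻ (cₛ -ᶻ c₀)) +ᶻ e)
                            ≡ (f +ᶻ + 2 *ᶻ σ) +ᶻ + 2 *ᶻ (e +ᶻ cₛ)
  regroup = ℤ-solve

-- Series are only ever multiplied by polynomials in q, so such products are modelled as
-- operators on series.
record Linear (Φ : Series → Series) : Set where
  field
    ≈-cong : ∀ {X Y} → X ≈ Y → Φ X ≈ Φ Y
    ⊕-hom  : ∀ X Y → Φ (X ⊕ Y) ≈ Φ X ⊕ Φ Y
    ⊖-hom  : ∀ X Y → Φ (X ⊖ Y) ≈ Φ X ⊖ Φ Y
    •-hom  : ∀ c X → Φ (c • X) ≈ c • Φ X
    q^-hom : ∀ u X → Φ (q^ u · X) ≈ q^ u · Φ X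

  𝟘-hom : Φ 𝟘 ≈ 𝟘
  𝟘-hom = coeffwise λ n → trans (coeff (⊖-hom 𝟘 𝟘) n) (ℤ.+-inverseʳ (Φ 𝟘 n))

  •-q^-hom : ∀ c u X → Φ (c • q^ u · X) ≈ c • q^ u · Φ X
  •-q^-hom c u X = ≈-trans (•-hom c (q^ u · X)) (•-cong c (q^-hom u X))

  1-q^-hom : ∀ u X → Φ (1-q^ u · X) ≈ 1-q^ u · Φ X
  1-q^-hom u X = ≈-trans (⊖-hom X (q^ u · X)) (⊖-congˡ (Φ X) (q^-hom u X))

  ∑-hom : ∀ r F → Φ (∑ r F) ≈ ∑ r (λ k → Φ (F k))
  ∑-hom zero    F = 𝟘-hom
  ∑-hom (suc r) F = ≈-trans (⊕-hom (∑ r F) (F (suc r))) (⊕-congʳ (Φ (F (suc r))) (∑-hom r F))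

  ∑±-hom : ∀ s F → Φ (∑± s F) ≈ ∑± s (λ k → Φ (F k))
  ∑±-hom s F = ≈-trans (⊕-hom (F 0) (+ 2 • ∑ s F))
                       (⊕-congˡ (Φ (F 0)) (≈-trans (•-hom (+ 2) (∑ s F)) (•-cong (+ 2) (∑-hom s F))))

id-linear : Linear (λ X → X)
id-linear = record
  { ≈-cong = λ X≈Y → X≈Y
  ; ⊕-hom  = λ _ _ → ≈-refl
  ; ⊖-hom  = λ _ _ → ≈-refl
  ; •-hom  = λ _ _ → ≈-refl
  ; q^-hom = λ _ _ → ≈-refl
  }

q^-linear : ∀ u → Linear (q^ u ·_)
q^-linear u = record
  { ≈-cong = q^-cong u
  ; ⊕-hom  = q^-⊕ u
  ; ⊖-hom  = q^-⊖ u
  ; •-hom  = q^-• u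
  ; q^-hom = q^-comm u
  }

•-linear : ∀ c → Linear (c •_)
•-linear c = record
  { ≈-cong = •-cong c
  ; ⊕-hom  = λ X Y → coeffwise λ n → ℤ.*-distribˡ-+ c (X n) (Y n)
  ; ⊖-hom  = λ X Y → coeffwise λ n → distrib c (X n) (Y n)
  ; •-hom  = λ d X → coeffwise λ n → swap c d (X n)
  ; q^-hom = λ u X → ≈-sym (q^-• u c X)
  }
  where
  distrib : ∀ c a b → c *ᶻ (a -ᶻ b) ≡ c *ᶻ a -ᶻ c *ᶻ b
  distrib = ℤ-solve
  swap : ∀ c d a → c *ᶻ (d *ᶻ a) ≡ d *ᶻ (c *ᶻ a)
  swap = ℤ-solve

∘-linear : ∀ {Φ Ψ} → Linear Φ → Linear Ψ → Linear (λ X → Φ (Ψ X))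
∘-linear {Φ} {Ψ} LΦ LΨ = record
  { ≈-cong = λ X≈Y → Φ.≈-cong (Ψ.≈-cong X≈Y)
  ; ⊕-hom  = λ X Y → ≈-trans (Φ.≈-cong (Ψ.⊕-hom X Y)) (Φ.⊕-hom (Ψ X) (Ψ Y))
  ; ⊖-hom  = λ X Y → ≈-trans (Φ.≈-cong (Ψ.⊖-hom X Y)) (Φ.⊖-hom (Ψ X) (Ψ Y))
  ; •-hom  = λ c X → ≈-trans (Φ.≈-cong (Ψ.•-hom c X)) (Φ.•-hom c (Ψ X))
  ; q^-hom = λ u X → ≈-trans (Φ.≈-cong (Ψ.q^-hom u X)) (Φ.q^-hom u (Ψ X))
  }
  where
  module Φ = Linear LΦ
  module Ψ = Linear LΨ

⊖-linear : ∀ {Φ Ψ} → Linear Φ → Linear Ψ → Linear (λ X → Φ X ⊖ Ψ X)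
⊖-linear {Φ} {Ψ} LΦ LΨ = record
  { ≈-cong = λ X≈Y → ⊖-cong (Φ.≈-cong X≈Y) (Ψ.≈-cong X≈Y)
  ; ⊕-hom  = λ X Y → ≈-trans (⊖-cong (Φ.⊕-hom X Y) (Ψ.⊕-hom X Y))
                             (coeffwise λ n → interchange (Φ X n) (Φ Y n) (Ψ X n) (Ψ Y n))
  ; ⊖-hom  = λ X Y → ≈-trans (⊖-cong (Φ.⊖-hom X Y) (Ψ.⊖-hom X Y))
                             (coeffwise λ n → interchange′ (Φ X n) (Φ Y n) (Ψ X n) (Ψ Y n))
  ; •-hom  = λ c X → ≈-trans (⊖-cong (Φ.•-hom c X) (Ψ.•-hom c X))
                             (coeffwise λ n → distrib c (Φ X n) (Ψ X n))
  ; q^-hom = λ u X → ≈-trans (⊖-cong (Φ.q^-hom u X) (Ψ.q^-hom u X))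
                             (≈-sym (q^-⊖ u (Φ X) (Ψ X)))
  }
  where
  module Φ = Linear LΦ
  module Ψ = Linear LΨ
  interchange : ∀ a b c d → (a +ᶻ b) -ᶻ (c +ᶻ d) ≡ (a -ᶻ c) +ᶻ (b -ᶻ d)
  interchange = ℤ-solve
  interchange′ : ∀ a b c d → (a -ᶻ b) -ᶻ (c -ᶻ d) ≡ (a -ᶻ c) -ᶻ (b -ᶻ d)
  interchange′ = ℤ-solve
  distrib : ∀ c a b → c *ᶻ a -ᶻ c *ᶻ b ≡ c *ᶻ (a -ᶻ b)
  distrib = ℤ-solve

1-q^-linear : ∀ u → Linear (1-q^ u ·_)
1-q^-linear u = ⊖-linear id-linear (q^-linear u)

1-q^-comm : ∀ u v X → 1-q^ u · 1-q^ v · X ≈ 1-q^ v · 1-q^ u · X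
1-q^-comm u v X = Linear.1-q^-hom (1-q^-linear u) v X

-- poch a r X = (1 - q^{a+1}) ⋯ (1 - q^{a+r}) X, that is (q^{a+1}; q)_r X.
poch : ℕ → ℕ → Series → Series
poch a zero    X = X
poch a (suc r) X = 1-q^ (a + suc r) · poch a r X

-- odd s X = (1 - q)(1 - q³) ⋯ (1 - q^{2s-1}) X, that is (q; q²)_s X.
odd : ℕ → Series → Series
odd zero    X = X
odd (suc s) X = 1-q^ (s + suc s) · odd s X

poch-linear : ∀ a r → Linear (poch a r)
poch-linear a zero    = id-linear
poch-linear a (suc r) = ∘-linear (1-q^-linear (a + suc r)) (poch-linear a r)

odd-linear : ∀ s → Linear (odd s)
odd-linear zero    = id-linear
odd-linear (suc s) = ∘-linear (1-q^-linear (s + suc s)) (odd-linear s)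

poch-low : ∀ a r X {d} → d ≤ a → poch a r X d ≡ X d
poch-low a zero    X d≤a = refl
poch-low a (suc r) X d≤a =
  trans (1-q^-< (a + suc r) (poch a r X) (ℕ.≤-<-trans d≤a (ℕ.m<m+n a (s≤s z≤n))))
        (poch-low a r X d≤a)

poch-+ : ∀ a t r X → poch a (t + r) X ≈ poch (a + r) t (poch a r X)
poch-+ a zero    r X = ≈-refl
poch-+ a (suc t) r X = begin
  1-q^ (a + suc (t + r)) · poch a (t + r) X  ≈⟨ 1-q^-cong (a + suc (t + r)) (poch-+ a t r X) ⟩
  1-q^ (a + suc (t + r)) · Y                 ≡⟨ cong (λ e → 1-q^ e · Y) (exponent a t r) ⟩
  1-q^ (a + r + suc t) · Y                   ∎
  where
  open ≈-Reasoning
  Y = poch (a + r) t (poch a r X)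
  exponent : ∀ a t r → a + suc (t + r) ≡ a + r + suc t
  exponent = ℕ-solve

poch-prefix : ∀ r s X {d} → d ≤ r → r ≤ s → poch 0 s X d ≡ poch 0 r X d
poch-prefix r s X {d} d≤r r≤s = begin
  poch 0 s X d                          ≡⟨ cong (λ m → poch 0 m X d) (ℕ.m∸n+n≡m r≤s) ⟨
  poch 0 ((s ∸ r) + r) X d              ≡⟨ coeff (poch-+ 0 (s ∸ r) r X) d ⟩
  poch r (s ∸ r) (poch 0 r X) d         ≡⟨ poch-low r (s ∸ r) (poch 0 r X) d≤r ⟩
  poch 0 r X d                          ∎
  where open ≡-Reasoning

-- qBinom a b X = [a+b choose a]_q X, the Gaussian binomial coefficient.
qBinom : ℕ → ℕ → Series → Series
qBinom zero    b       X = X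
qBinom (suc a) zero    X = X
qBinom (suc a) (suc b) X = qBinom a (suc b) X ⊕ q^ suc a · qBinom (suc a) b X

qBinom-zeroʳ : ∀ a X → qBinom a 0 X ≡ X
qBinom-zeroʳ zero    X = refl
qBinom-zeroʳ (suc a) X = refl

-- Both sides equal (q; q)_{a+b+1} / ((q; q)_a (q; q)_b) X.
qBinom-1-q^ʳ : ∀ a b X → 1-q^ suc b · qBinom a (suc b) X ≈ 1-q^ suc (a + b) · qBinom a b X
qBinom-1-q^ˡ : ∀ a b X → 1-q^ suc a · qBinom (suc a) b X ≈ 1-q^ suc (a + b) · qBinom a b X

qBinom-1-q^ʳ zero    b X = ≈-refl
qBinom-1-q^ʳ (suc a) b X = begin
  1-q^ suc b · (qBinom a (suc b) X ⊕ q^ suc a · Y)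
    ≈⟨ Linear.⊕-hom (1-q^-linear (suc b)) (qBinom a (suc b) X) (q^ suc a · Y) ⟩
  1-q^ suc b · qBinom a (suc b) X ⊕ 1-q^ suc b · q^ suc a · Y
    ≈⟨ ⊕-cong (≈-trans (qBinom-1-q^ʳ a b X) (≈-sym (qBinom-1-q^ˡ a b X)))
              (Linear.q^-hom (1-q^-linear (suc b)) (suc a) Y) ⟩
  1-q^ suc a · Y ⊕ q^ suc a · 1-q^ suc b · Y
    ≈⟨ 1-q^-+ (suc a) (suc b) Y ⟩
  1-q^ (suc a + suc b) · Y
    ≡⟨ cong (λ e → 1-q^ e · Y) (ℕ.+-suc (suc a) b) ⟩
  1-q^ suc (suc a + b) · Y ∎
  where
  open ≈-Reasoning
  Y = qBinom (suc a) b X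

qBinom-1-q^ˡ zero    zero    X = ≈-refl
qBinom-1-q^ˡ (suc a) zero    X = ≡⇒≈ (cong (λ e → 1-q^ suc e · X) (sym (ℕ.+-identityʳ (suc a))))
qBinom-1-q^ˡ a       (suc b) X = begin
  1-q^ suc a · (Z ⊕ q^ suc a · qBinom (suc a) b X)
    ≈⟨ Linear.⊕-hom (1-q^-linear (suc a)) Z (q^ suc a · qBinom (suc a) b X) ⟩
  1-q^ suc a · Z ⊕ 1-q^ suc a · q^ suc a · qBinom (suc a) b X
    ≈⟨ ⊕-congˡ (1-q^ suc a · Z)
         (≈-trans (Linear.q^-hom (1-q^-linear (suc a)) (suc a) (qBinom (suc a) b X))
                  (q^-cong (suc a) (≈-trans (qBinom-1-q^ˡ a b X) (≈-sym (qBinom-1-q^ʳ a b X))))) ⟩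
  1-q^ suc a · Z ⊕ q^ suc a · 1-q^ suc b · Z
    ≈⟨ 1-q^-+ (suc a) (suc b) Z ⟩
  1-q^ suc (a + suc b) · Z ∎
  where
  open ≈-Reasoning
  Z = qBinom a (suc b) X

qBinom-pascal′ : ∀ a b X → qBinom (suc a) (suc b) X ≈ q^ suc b · qBinom a (suc b) X ⊕ qBinom (suc a) b X
qBinom-pascal′ a b X = coeffwise λ n → rearrange (P n) ((q^ suc b · P) n) (R n) ((q^ suc a · R) n)
  (coeff (≈-trans (qBinom-1-q^ʳ a b X) (≈-sym (qBinom-1-q^ˡ a b X))) n)
  where
  P = qBinom a (suc b) X
  R = qBinom (suc a) b X
  rearrange : ∀ p p′ r r′ → p -ᶻ p′ ≡ r -ᶻ r′ → p +ᶻ r′ ≡ p′ +ᶻ r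
  rearrange p p′ r r′ eq = begin
    p +ᶻ r′                       ≡⟨ shuffle p p′ r′ ⟩
    (p -ᶻ p′) +ᶻ (p′ +ᶻ r′)       ≡⟨ cong (_+ᶻ (p′ +ᶻ r′)) eq ⟩
    (r -ᶻ r′) +ᶻ (p′ +ᶻ r′)       ≡⟨ shuffle′ r r′ p′ ⟩
    p′ +ᶻ r                       ∎
    where
    open ≡-Reasoning
    shuffle : ∀ p p′ r′ → p +ᶻ r′ ≡ (p -ᶻ p′) +ᶻ (p′ +ᶻ r′)
    shuffle = ℤ-solve
    shuffle′ : ∀ r r′ p′ → (r -ᶻ r′) +ᶻ (p′ +ᶻ r′) ≡ p′ +ᶻ r
    shuffle′ = ℤ-solve

qBinom-comm : ∀ a b X → qBinom a b X ≈ qBinom b a X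
qBinom-comm zero    zero    X = ≈-refl
qBinom-comm zero    (suc b) X = ≈-refl
qBinom-comm (suc a) zero    X = ≈-refl
qBinom-comm (suc a) (suc b) X = begin
  qBinom a (suc b) X ⊕ q^ suc a · qBinom (suc a) b X
    ≈⟨ ⊕-cong (qBinom-comm a (suc b) X) (q^-cong (suc a) (qBinom-comm (suc a) b X)) ⟩
  qBinom (suc b) a X ⊕ q^ suc a · qBinom b (suc a) X
    ≈⟨ ⊕-comm (qBinom (suc b) a X) _ ⟩
  q^ suc a · qBinom b (suc a) X ⊕ qBinom (suc b) a X
    ≈⟨ qBinom-pascal′ b a X ⟨
  qBinom (suc b) (suc a) X ∎
  where open ≈-Reasoning

qBinom-step : ∀ a b X → qBinom (suc a) (suc b) X ≈
  1-q^ suc (a + b) · qBinom a b X ⊕ q^ suc a · qBinom (suc a) b X ⊕ q^ suc b · qBinom a (suc b) X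
qBinom-step a b X = begin
  P ⊕ q^ suc a · R                                          ≈⟨ coeffwise (λ n → regroup (P n) _ _) ⟩
  1-q^ suc b · P ⊕ q^ suc a · R ⊕ q^ suc b · P              ≈⟨ ⊕-congʳ _ (⊕-congʳ _ (qBinom-1-q^ʳ a b X)) ⟩
  1-q^ suc (a + b) · qBinom a b X ⊕ q^ suc a · R ⊕ q^ suc b · P ∎
  where
  open ≈-Reasoning
  P = qBinom a (suc b) X
  R = qBinom (suc a) b X
  regroup : ∀ p r p′ → p +ᶻ r ≡ (p -ᶻ p′) +ᶻ r +ᶻ p′
  regroup = ℤ-solve

poch-qBinom : ∀ a b X → poch 0 b (qBinom a b X) ≈ poch a b X
poch-qBinom a zero    X = ≡⇒≈ (qBinom-zeroʳ a X)
poch-qBinom a (suc b) X = begin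
  1-q^ suc b · poch 0 b (qBinom a (suc b) X)    ≈⟨ P.1-q^-hom (suc b) (qBinom a (suc b) X) ⟨
  poch 0 b (1-q^ suc b · qBinom a (suc b) X)    ≈⟨ P.≈-cong (qBinom-1-q^ʳ a b X) ⟩
  poch 0 b (1-q^ suc (a + b) · qBinom a b X)    ≈⟨ P.1-q^-hom (suc (a + b)) (qBinom a b X) ⟩
  1-q^ suc (a + b) · poch 0 b (qBinom a b X)    ≈⟨ 1-q^-cong (suc (a + b)) (poch-qBinom a b X) ⟩
  1-q^ suc (a + b) · poch a b X                 ≡⟨ cong (λ e → 1-q^ e · poch a b X) (ℕ.+-suc a b) ⟨
  1-q^ (a + suc b) · poch a b X                 ∎
  where
  open ≈-Reasoning
  module P = Linear (poch-linear 0 b)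

poch-qBinom-low : ∀ a t s X {e} → e ≤ t → t ≤ s → e ≤ a → poch 0 s (qBinom a t X) e ≡ X e
poch-qBinom-low a t s X {e} e≤t t≤s e≤a = begin
  poch 0 s (qBinom a t X) e   ≡⟨ poch-prefix t s (qBinom a t X) e≤t t≤s ⟩
  poch 0 t (qBinom a t X) e   ≡⟨ coeff (poch-qBinom a t X) e ⟩
  poch a t X e                ≡⟨ poch-low a t X e≤a ⟩
  X e                         ∎
  where open ≡-Reasoning

-- The finite Gauss identity (q; q²)_s = ∑_{k = -s}^{s} (-1)^k q^{k²} [2s choose s+k]_q

θ-term : ℕ → Series → Series
θ-term k X = -1ℤ ^ᶻ k • q^ (k * k) · X

θ-term-linear : ∀ k → Linear (θ-term k)
θ-term-linear k = ∘-linear (•-linear (-1ℤ ^ᶻ k)) (q^-linear (k * k))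

θ-term-q^ : ∀ k u X → θ-term k (q^ u · X) ≈ -1ℤ ^ᶻ k • q^ (k * k + u) · X
θ-term-q^ k u X = •-cong (-1ℤ ^ᶻ k) (q^-+ (k * k) u X)

θ-term-cong-at : ∀ k n {X Y} → (k * k ≤ n → X (n ∸ k * k) ≡ Y (n ∸ k * k)) →
                 θ-term k X n ≡ θ-term k Y n
θ-term-cong-at k n eq = cong (-1ℤ ^ᶻ k *ᶻ_) (q^-cong-at (k * k) n eq)

gaussTerm : ℕ → ℕ → Series → Series
gaussTerm s k X = θ-term k (qBinom (s + k) (s ∸ k) X)

-- qBinom-step splits gaussTerm (s + 1) k into (1 - q^{2s+1}) gaussTerm s k and these two terms,
-- which telescope in k because crossTerm⁻ s (k + 1) = - crossTerm⁺ s k.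
crossTerm⁺ crossTerm⁻ : ℕ → ℕ → Series → Series
crossTerm⁺ s k X = -1ℤ ^ᶻ k • q^ (k * k + suc (s + k)) · qBinom (suc (s + k)) (s ∸ k) X
crossTerm⁻ s k X = -1ℤ ^ᶻ k • q^ (k * k + suc (s ∸ k)) · qBinom (s + k) (suc (s ∸ k)) X

gaussTerm-suc : ∀ s k X → k ≤ s →
  gaussTerm (suc s) k X ≈ 1-q^ (s + suc s) · gaussTerm s k X ⊕ crossTerm⁺ s k X ⊕ crossTerm⁻ s k X
gaussTerm-suc s k X k≤s = begin
  θ-term k (qBinom (suc (s + k)) (suc s ∸ k) X)
    ≡⟨ cong (λ b → θ-term k (qBinom (suc (s + k)) b X)) (ℕ.+-∸-assoc 1 k≤s) ⟩
  θ-term k (qBinom (suc (s + k)) (suc (s ∸ k)) X)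
    ≈⟨ M.≈-cong (qBinom-step (s + k) (s ∸ k) X) ⟩
  θ-term k (1-q^ e · G ⊕ q^ suc (s + k) · G⁺ ⊕ q^ suc (s ∸ k) · G⁻)
    ≈⟨ ≈-trans (M.⊕-hom _ _) (⊕-congʳ _ (M.⊕-hom _ _)) ⟩
  θ-term k (1-q^ e · G) ⊕ θ-term k (q^ suc (s + k) · G⁺) ⊕ θ-term k (q^ suc (s ∸ k) · G⁻)
    ≈⟨ ⊕-cong (⊕-cong (M.1-q^-hom e G) (θ-term-q^ k (suc (s + k)) G⁺)) (θ-term-q^ k (suc (s ∸ k)) G⁻) ⟩
  1-q^ e · gaussTerm s k X ⊕ crossTerm⁺ s k X ⊕ crossTerm⁻ s k X
    ≡⟨ cong (λ u → 1-q^ u · gaussTerm s k X ⊕ crossTerm⁺ s k X ⊕ crossTerm⁻ s k X) exponent ⟩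
  1-q^ (s + suc s) · gaussTerm s k X ⊕ crossTerm⁺ s k X ⊕ crossTerm⁻ s k X ∎
  where
  open ≈-Reasoning
  module M = Linear (θ-term-linear k)
  e  = suc (s + k + (s ∸ k))
  G  = qBinom (s + k) (s ∸ k) X
  G⁺ = qBinom (suc (s + k)) (s ∸ k) X
  G⁻ = qBinom (s + k) (suc (s ∸ k)) X
  exponent : e ≡ s + suc s
  exponent = trans (cong suc (trans (ℕ.+-assoc s k (s ∸ k)) (cong (_+_ s) (ℕ.m+[n∸m]≡n k≤s))))
                   (sym (ℕ.+-suc s s))

crossTerm⁻-zero : ∀ s X → crossTerm⁻ s 0 X ≈ crossTerm⁺ s 0 X
crossTerm⁻-zero s X rewrite ℕ.+-identityʳ s = •-cong 1ℤ (q^-cong (suc s) (qBinom-comm s (suc s) X))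

crossTerm⁻-suc : ∀ s j X → j < s → crossTerm⁻ s (suc j) X ≈ -1ℤ • crossTerm⁺ s j X
crossTerm⁻-suc s j X j<s = begin
  (-1ℤ *ᶻ c) • q^ (suc j * suc j + suc (s ∸ suc j)) · qBinom (s + suc j) (suc (s ∸ suc j)) X
    ≡⟨ cong₂ (λ e Y → (-1ℤ *ᶻ c) • q^ e · Y) exponent
             (cong₂ (λ a b → qBinom a b X) (ℕ.+-suc s j) (sym (ℕ.+-∸-assoc 1 j<s))) ⟩
  (-1ℤ *ᶻ c) • q^ (j * j + suc (s + j)) · qBinom (suc (s + j)) (s ∸ j) X
    ≈⟨ coeffwise (λ n → ℤ.*-assoc -1ℤ c _) ⟩
  -1ℤ • crossTerm⁺ s j X ∎
  where
  open ≈-Reasoning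
  c = -1ℤ ^ᶻ j
  arithmetic : ∀ j t → suc j * suc j + suc t ≡ j * j + suc (suc j + t + j)
  arithmetic = ℕ-solve
  exponent : suc j * suc j + suc (s ∸ suc j) ≡ j * j + suc (s + j)
  exponent = trans (arithmetic j (s ∸ suc j)) (cong (λ m → j * j + suc (m + j)) (ℕ.m+[n∸m]≡n j<s))

gaussTerm-last : ∀ s X → gaussTerm (suc s) (suc s) X ⊕ crossTerm⁺ s s X ≈ 𝟘
gaussTerm-last s X = coeffwise λ n → begin
  (-1ℤ *ᶻ c) *ᶻ (q^ (suc s * suc s) · qBinom (suc (s + suc s)) (s ∸ s) X) n
    +ᶻ c *ᶻ (q^ e · qBinom (suc (s + s)) (s ∸ s) X) n
    ≡⟨ cong₂ (λ e′ t → (-1ℤ *ᶻ c) *ᶻ (q^ e′ · qBinom (suc (s + suc s)) t X) n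
                       +ᶻ c *ᶻ (q^ e · qBinom (suc (s + s)) t X) n)
             (square s) (ℕ.n∸n≡0 s) ⟩
  (-1ℤ *ᶻ c) *ᶻ (q^ e · X) n +ᶻ c *ᶻ (q^ e · X) n
    ≡⟨ cancel c ((q^ e · X) n) ⟩
  0ℤ ∎
  where
  open ≡-Reasoning
  c = -1ℤ ^ᶻ s
  e = s * s + suc (s + s)
  square : ∀ s → suc s * suc s ≡ s * s + suc (s + s)
  square = ℕ-solve
  cancel : ∀ c x → (-1ℤ *ᶻ c) *ᶻ x +ᶻ c *ᶻ x ≡ 0ℤ
  cancel = ℤ-solve

gauss : ∀ s X → odd s X ≈ ∑± s (λ k → gaussTerm s k X)
gauss zero    X = coeffwise λ n → sym (unit (X n))
  where
  unit : ∀ x → 1ℤ *ᶻ x +ᶻ + 2 *ᶻ 0ℤ ≡ x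
  unit = ℤ-solve
gauss (suc s) X = begin
  1-q^ (s + suc s) · odd s X
    ≈⟨ 1-q^-cong (s + suc s) (gauss s X) ⟩
  1-q^ (s + suc s) · ∑± s (λ k → gaussTerm s k X)
    ≈⟨ Linear.∑±-hom (1-q^-linear (s + suc s)) s (λ k → gaussTerm s k X) ⟩
  ∑± s F
    ≈⟨ ∑±-telescope s F (λ k → gaussTerm (suc s) k X) C first middle last ⟨
  ∑± (suc s) (λ k → gaussTerm (suc s) k X) ∎
  where
  open ≈-Reasoning
  F C : ℕ → Series
  F k = 1-q^ (s + suc s) · gaussTerm s k X
  C k = crossTerm⁺ s k X
  first : gaussTerm (suc s) 0 X ≈ F 0 ⊕ + 2 • C 0
  first = ≈-trans (gaussTerm-suc s 0 X z≤n)
                  (≈-trans (⊕-congˡ (F 0 ⊕ C 0) (crossTerm⁻-zero s X))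
                           (coeffwise λ n → double (F 0 n) (C 0 n)))
    where
    double : ∀ f c → f +ᶻ c +ᶻ c ≡ f +ᶻ + 2 *ᶻ c
    double = ℤ-solve
  middle : ∀ {k} → 1 ≤ k → k ≤ s → gaussTerm (suc s) k X ≈ F k ⊕ (C k ⊖ C (pred k))
  middle {suc j} _ j<s = ≈-trans (gaussTerm-suc s (suc j) X j<s)
                                 (≈-trans (⊕-congˡ (F (suc j) ⊕ C (suc j)) (crossTerm⁻-suc s j X j<s))
                                          (coeffwise λ n → regroup (F (suc j) n) (C (suc j) n) (C j n)))
    where
    regroup : ∀ f c c′ → f +ᶻ c +ᶻ -1ℤ *ᶻ c′ ≡ f +ᶻ (c -ᶻ c′)
    regroup = ℤ-solve
  last : gaussTerm (suc s) (suc s) X ⊕ C s ≈ 𝟘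
  last = gaussTerm-last s X

-- θ s X = ∑_{k = -s}^{s} (-1)^k q^{k²} X, a truncation of θ(-q) X.
θ : ℕ → Series → Series
θ s X = ∑± s (λ k → θ-term k X)

Q : ℕ → Series → Series
Q s X = poch 0 s (odd s X)

Q-linear : ∀ s → Linear (Q s)
Q-linear s = ∘-linear (poch-linear 0 s) (odd-linear s)

k≤k*k : ∀ k → k ≤ k * k
k≤k*k zero    = z≤n
k≤k*k (suc k) = ℕ.m≤m*n (suc k) (suc k)

-- (q; q)_s [2s choose s+k]_q ≡ 1 modulo q^{s-k+1}, so the Gauss identity gives Q s ≡ θ s modulo q^{s+1}.
Q-low : ∀ s X {d} → d ≤ s → Q s X d ≡ θ s X d
Q-low s X {d} d≤s = begin
  Q s X d
    ≡⟨ coeff (≈-trans (P.≈-cong (gauss s X)) (P.∑±-hom s (λ k → gaussTerm s k X))) d ⟩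
  ∑± s (λ k → poch 0 s (gaussTerm s k X)) d
    ≡⟨ ∑±-cong-at s (λ k → poch 0 s (gaussTerm s k X)) (λ k → θ-term k X) d term ⟩
  θ s X d ∎
  where
  open ≡-Reasoning
  module P = Linear (poch-linear 0 s)
  term : ∀ {k} → k ≤ s → poch 0 s (gaussTerm s k X) d ≡ θ-term k X d
  term {k} k≤s = begin
    poch 0 s (θ-term k G) d   ≡⟨ coeff (P.•-q^-hom (-1ℤ ^ᶻ k) (k * k) G) d ⟩
    θ-term k (poch 0 s G) d   ≡⟨ θ-term-cong-at k d low ⟩
    θ-term k X d              ∎
    where
    G = qBinom (s + k) (s ∸ k) X
    low : k * k ≤ d → poch 0 s G (d ∸ k * k) ≡ X (d ∸ k * k)
    low _ = poch-qBinom-low (s + k) (s ∸ k) s X (ℕ.∸-mono d≤s (k≤k*k k)) (ℕ.m∸n≤m s k)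
              (ℕ.≤-trans (ℕ.m∸n≤m d (k * k)) (ℕ.≤-trans d≤s (ℕ.m≤m+n s k)))

Q-suc : ∀ s X → Q (suc s) X ≈ Q s (1-q^ (s + suc s) · 1-q^ suc s · X)
Q-suc s X = begin
  1-q^ suc s · poch 0 s (1-q^ (s + suc s) · odd s X)  ≈⟨ 1-q^-cong (suc s) (P.≈-cong (O.1-q^-hom (s + suc s) X)) ⟨
  1-q^ suc s · Q s (1-q^ (s + suc s) · X)             ≈⟨ Qₛ.1-q^-hom (suc s) (1-q^ (s + suc s) · X) ⟨
  Q s (1-q^ suc s · 1-q^ (s + suc s) · X)             ≈⟨ Qₛ.≈-cong (1-q^-comm (suc s) (s + suc s) X) ⟩
  Q s (1-q^ (s + suc s) · 1-q^ suc s · X)             ∎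
  where
  open ≈-Reasoning
  module P  = Linear (poch-linear 0 s)
  module O  = Linear (odd-linear s)
  module Qₛ = Linear (Q-linear s)

Q-inverse : (A B : ℕ → Series) → A 0 ≈ 𝟙 →
            (∀ s → 1-q^ suc s · A (suc s) ≈ B s) → (∀ s → 1-q^ (s + suc s) · B s ≈ A s) →
            ∀ s → Q s (A s) ≈ 𝟙
Q-inverse A B A-zero A-suc B-rec zero    = A-zero
Q-inverse A B A-zero A-suc B-rec (suc s) = begin
  Q (suc s) (A (suc s))                           ≈⟨ Q-suc s (A (suc s)) ⟩
  Q s (1-q^ (s + suc s) · 1-q^ suc s · A (suc s)) ≈⟨ Qₛ.≈-cong (1-q^-cong (s + suc s) (A-suc s)) ⟩
  Q s (1-q^ (s + suc s) · B s)                    ≈⟨ Qₛ.≈-cong (B-rec s) ⟩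
  Q s (A s)                                       ≈⟨ Q-inverse A B A-zero A-suc B-rec s ⟩
  𝟙                                               ∎
  where
  open ≈-Reasoning
  module Qₛ = Linear (Q-linear s)

-- Enumerations

Unique-⊆⇒length≤ : ∀ {A : Set} {xs ys : List A} → Unique xs → xs ⊆ ys → length xs ≤ length ys
Unique-⊆⇒length≤ {xs = []}     _            _     = z≤n
Unique-⊆⇒length≤ {xs = x ∷ xs} (x∉xs ∷ u) xs⊆ys with ∈-∃++ (xs⊆ys (here refl))
... | ys₁ , ys₂ , refl = ℕ.≤-trans (s≤s (Unique-⊆⇒length≤ u xs⊆ys₁++ys₂)) (ℕ.≤-reflexive length-middle)
  where
  xs⊆ys₁++ys₂ : xs ⊆ ys₁ ++ ys₂
  xs⊆ys₁++ys₂ {z} z∈xs with ∈-++⁻ ys₁ (xs⊆ys (there z∈xs))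
  ... | inj₁ z∈ys₁         = ∈-++⁺ˡ z∈ys₁
  ... | inj₂ (here refl)   = ⊥-elim (All.lookup x∉xs z∈xs refl)
  ... | inj₂ (there z∈ys₂) = ∈-++⁺ʳ ys₁ z∈ys₂
  length-middle : suc (length (ys₁ ++ ys₂)) ≡ length (ys₁ ++ x ∷ ys₂)
  length-middle = begin
    suc (length (ys₁ ++ ys₂))           ≡⟨ cong suc (List.length-++ ys₁) ⟩
    suc (length ys₁ + length ys₂)       ≡⟨ ℕ.+-suc (length ys₁) (length ys₂) ⟨
    length ys₁ + length (x ∷ ys₂)       ≡⟨ List.length-++ ys₁ ⟨
    length (ys₁ ++ x ∷ ys₂)             ∎
    where open ≡-Reasoning

record Enumeration {A : Set} (P : A → Set) : Set where
  constructor enumeration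
  field
    list     : List A
    unique   : Unique list
    complete : ∀ x → P x → x ∈ list
    sound    : ∀ x → x ∈ list → P x

  size : ℕ
  size = length list

open Enumeration

module _ {A : Set} where

  size-unique : ∀ {P : A → Set} (E F : Enumeration P) → size E ≡ size F
  size-unique E F = ℕ.≤-antisym (included E F) (included F E)
    where
    included : ∀ E F → size E ≤ size F
    included E F = Unique-⊆⇒length≤ (unique E) λ {x} x∈E → complete F x (sound E x x∈E)

  Enumeration-⇔ : ∀ {P P′ : A → Set} → (∀ {x} → P x → P′ x) → (∀ {x} → P′ x → P x) →
                  Enumeration P → Enumeration P′
  Enumeration-⇔ to from (enumeration L u c s) =
    enumeration L u (λ x p′ → c x (from p′)) (λ x x∈L → to (s x x∈L))

  Enumeration-∅ : ∀ {P : A → Set} → (∀ {x} → ¬ P x) → Enumeration P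
  Enumeration-∅ ¬P = enumeration [] [] (λ x p → ⊥-elim (¬P p)) (λ x ())

  module DisjointUnion {P P₁ P₂ : A → Set} (f : A → A) (f-injective : Injective _≡_ _≡_ f)
    (split : ∀ {x} → P x → P₁ x ⊎ ∃[ y ] x ≡ f y × P₂ y)
    (from₁ : ∀ {x} → P₁ x → P x) (from₂ : ∀ {y} → P₂ y → P (f y)) (disjoint : ∀ {y} → ¬ P₁ (f y))
    where

    union : Enumeration P₁ → Enumeration P₂ → Enumeration P
    union E₁ E₂ = enumeration (list E₁ ++ map f (list E₂))
      (Unique.++⁺ (unique E₁) (Unique.map⁺ f-injective (unique E₂)) apart) complete′ sound′
      where
      apart : ∀ {x} → ¬ (x ∈ list E₁ × x ∈ map f (list E₂))
      apart (x∈E₁ , x∈fE₂) with ∈-map⁻ f x∈fE₂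
      ... | y , _ , refl = disjoint (sound E₁ (f y) x∈E₁)
      complete′ : ∀ x → P x → x ∈ list E₁ ++ map f (list E₂)
      complete′ x p with split p
      ... | inj₁ p₁             = ∈-++⁺ˡ (complete E₁ x p₁)
      ... | inj₂ (y , refl , p₂) = ∈-++⁺ʳ (list E₁) (∈-map⁺ f (complete E₂ y p₂))
      sound′ : ∀ x → x ∈ list E₁ ++ map f (list E₂) → P x
      sound′ x x∈ with ∈-++⁻ (list E₁) x∈
      ... | inj₁ x∈E₁ = from₁ (sound E₁ x x∈E₁)
      ... | inj₂ x∈fE₂ with ∈-map⁻ f x∈fE₂
      ...   | y , y∈E₂ , refl = from₂ (sound E₂ y y∈E₂)

    size-union : ∀ (E : Enumeration P) E₁ E₂ → size E ≡ size E₁ + size E₂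
    size-union E E₁ E₂ = begin
      size E                                    ≡⟨ size-unique E (union E₁ E₂) ⟩
      length (list E₁ ++ map f (list E₂))       ≡⟨ List.length-++ (list E₁) ⟩
      size E₁ + length (map f (list E₂))        ≡⟨ cong (_+_ (size E₁)) (List.length-map f (list E₂)) ⟩
      size E₁ + size E₂                         ∎
      where open ≡-Reasoning

  Shifted : ℕ → (ℕ → A → Set) → ℕ → A → Set
  Shifted u P n x = u ≤ n × P (n ∸ u) x

  shifted : ∀ u {P : ℕ → A → Set} n →
            (u ≤ n → Enumeration (P (n ∸ u))) → Enumeration (Shifted u P n)
  shifted u n E with u ≤? n
  ... | yes u≤n = Enumeration-⇔ (u≤n ,_) proj₂ (E u≤n)
  ... | no  u≰n = Enumeration-∅ (u≰n ∘ proj₁)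

  generating : ∀ {P : ℕ → A → Set} → (∀ n → Enumeration (P n)) → Series
  generating E n = + size (E n)

  size-shifted : ∀ u {P : ℕ → A → Set} (E : ∀ n → Enumeration (P n)) n →
                 (F : Enumeration (Shifted u P n)) →
                 + size F ≡ (q^ u · generating E) n
  size-shifted u E n F with u ≤? n
  ... | yes u≤n = trans (cong +_ (size-unique F (Enumeration-⇔ (u≤n ,_) proj₂ (E (n ∸ u)))))
                        (sym (q^-≥ u (generating E) u≤n))
  ... | no  u≰n = trans (cong +_ (size-unique F (Enumeration-∅ (u≰n ∘ proj₁))))
                        (sym (q^-< u (generating E) (ℕ.≰⇒> u≰n)))

  1-q^-generating : ∀ u {P P₁ : ℕ → A → Set} →
                    (E : ∀ n → Enumeration (P n)) (E₁ : ∀ n → Enumeration (P₁ n)) →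
                    (∀ n (F : Enumeration (Shifted u P n)) → size (E n) ≡ size (E₁ n) + size F) →
                    1-q^ u · generating E ≈ generating E₁
  1-q^-generating u {P} E E₁ split = coeffwise coefficient
    where
    cancel : ∀ a c → (a +ᶻ c) -ᶻ c ≡ a
    cancel = ℤ-solve
    coefficient : ∀ n → (1-q^ u · generating E) n ≡ generating E₁ n
    coefficient n = begin
      + size (E n) -ᶻ (q^ u · generating E) n
        ≡⟨ cong₂ _-ᶻ_ (cong +_ (split n Eₙ₋ᵤ)) (sym (size-shifted u E n Eₙ₋ᵤ)) ⟩
      + (size (E₁ n) + size Eₙ₋ᵤ) -ᶻ + size Eₙ₋ᵤ
        ≡⟨ cong (_-ᶻ + size Eₙ₋ᵤ) (ℤ.pos-+ (size (E₁ n)) (size Eₙ₋ᵤ)) ⟩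
      (+ size (E₁ n) +ᶻ + size Eₙ₋ᵤ) -ᶻ + size Eₙ₋ᵤ
        ≡⟨ cancel (+ size (E₁ n)) (+ size Eₙ₋ᵤ) ⟩
      + size (E₁ n) ∎
      where
      open ≡-Reasoning
      Eₙ₋ᵤ = shifted u {P} n λ _ → E (n ∸ u)

-- Jagged partitions with bounded leading parts

Head≤ : ℕ → List ℕ → Set
Head≤ b []      = ⊤
Head≤ b (x ∷ _) = x ≤ b

Bounded : ℕ → ℕ → List ℕ → Set
Bounded a b xs = Head≤ a xs × Head≤ b (drop 1 xs)

𝒜 ℬ : ℕ → ℕ → List ℕ → Set
𝒜 s n xs = Is01Partition n xs × Bounded s s xs
ℬ s n xs = Is01Partition n xs × Bounded s (suc s) xs

Head≤-mono : ∀ {b b′} xs → b ≤ b′ → Head≤ b xs → Head≤ b′ xs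
Head≤-mono []      _    _   = tt
Head≤-mono (x ∷ _) b≤b′ x≤b = ℕ.≤-trans x≤b b≤b′

Bounded-sum : ∀ xs → Bounded (sum xs) (sum xs) xs
Bounded-sum []           = tt , tt
Bounded-sum (x ∷ [])     = ℕ.m≤m+n x 0 , tt
Bounded-sum (x ∷ y ∷ ys) = ℕ.m≤m+n x (y + sum ys) ,
                           ℕ.≤-trans (ℕ.m≤m+n y (sum ys)) (ℕ.m≤n+m (y + sum ys) x)

∸1≤⇒≤suc : ∀ y {x} → y ∸ 1 ≤ x → y ≤ suc x
∸1≤⇒≤suc zero    _   = z≤n
∸1≤⇒≤suc (suc y) y≤x = s≤s y≤x

Jagged-∷⁻ : ∀ x xs → Jagged (x ∷ xs) → Jagged xs × Bounded (suc x) x xs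
Jagged-∷⁻ x []          _                 = tt , tt , tt
Jagged-∷⁻ x (y ∷ [])    (y∸1≤x , j)       = j , ∸1≤⇒≤suc y y∸1≤x , tt
Jagged-∷⁻ x (y ∷ z ∷ r) (y∸1≤x , z≤x , j) = j , ∸1≤⇒≤suc y y∸1≤x , z≤x

Jagged-∷∷⁺ : ∀ x y ys → Jagged (y ∷ ys) → Bounded (suc x) x (y ∷ ys) → Jagged (x ∷ y ∷ ys)
Jagged-∷∷⁺ x y []      j (y≤1+x , _)   = ℕ.∸-monoˡ-≤ 1 y≤1+x , j
Jagged-∷∷⁺ x y (z ∷ r) j (y≤1+x , z≤x) = ℕ.∸-monoˡ-≤ 1 y≤1+x , z≤x , j

Jagged-suc∷⁺ : ∀ x xs → Jagged xs → Bounded (suc (suc x)) (suc x) xs → Jagged (suc x ∷ xs)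
Jagged-suc∷⁺ x []       _ _ = s≤s z≤n
Jagged-suc∷⁺ x (y ∷ ys) j b = Jagged-∷∷⁺ (suc x) y ys j b

sum-∷⁻ : ∀ x xs {n} → sum (x ∷ xs) ≡ n → x ≤ n × sum xs ≡ n ∸ x
sum-∷⁻ x xs refl = ℕ.m≤m+n x (sum xs) , sym (ℕ.m+n∸m≡n x (sum xs))

sum-∷⁺ : ∀ x xs {n} → x ≤ n → sum xs ≡ n ∸ x → sum (x ∷ xs) ≡ n
sum-∷⁺ x xs x≤n eq = trans (cong (_+_ x) eq) (ℕ.m+[n∸m]≡n x≤n)

¬Jagged-0∷0∷ : ∀ r → ¬ Jagged (0 ∷ 0 ∷ r)
¬Jagged-0∷0∷ []      (_ , ())
¬Jagged-0∷0∷ (z ∷ r) (_ , z≤n , j) = ¬Jagged-0∷0∷ r j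

𝒜₀-empty : ∀ {n} xs → 𝒜 0 n xs → xs ≡ []
𝒜₀-empty []          _                         = refl
𝒜₀-empty (x ∷ [])    ((_ , ()) , z≤n , _)
𝒜₀-empty (x ∷ y ∷ r) ((_ , j)  , z≤n , z≤n)    = ⊥-elim (¬Jagged-0∷0∷ r j)

𝒜-all : ∀ s {n} xs → n ≤ s → Is01Partition n xs → 𝒜 s n xs
𝒜-all s xs n≤s (Σ≡n , j) = (Σ≡n , j) , Head≤-mono xs Σ≤s (proj₁ (Bounded-sum xs))
                                     , Head≤-mono (drop 1 xs) Σ≤s (proj₂ (Bounded-sum xs))
  where Σ≤s = ℕ.≤-trans (ℕ.≤-reflexive Σ≡n) n≤s

ℬ⇒𝒜 : ∀ s {n} xs → ℬ s n xs → 𝒜 (suc s) n xs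
ℬ⇒𝒜 s xs (p , h₁ , h₂) = p , Head≤-mono xs (ℕ.n≤1+n s) h₁ , h₂

𝒜⇒ℬ : ∀ s {n} xs → 𝒜 s n xs → ℬ s n xs
𝒜⇒ℬ s xs (p , h₁ , h₂) = p , h₁ , Head≤-mono (drop 1 xs) (ℕ.n≤1+n s) h₂

𝒜-tail : ∀ s {n} ys → 𝒜 (suc s) n (suc s ∷ ys) → Shifted (suc s) (𝒜 (suc s)) n ys
𝒜-tail s ys ((Σ≡n , j) , _ , h) =
  proj₁ tail-sum , (proj₂ tail-sum , proj₁ tail-jagged) , h , proj₂ (proj₂ tail-jagged)
  where
  tail-sum = sum-∷⁻ (suc s) ys Σ≡n
  tail-jagged = Jagged-∷⁻ (suc s) ys j

𝒜-cons : ∀ s {n} ys → Shifted (suc s) (𝒜 (suc s)) n ys → 𝒜 (suc s) n (suc s ∷ ys)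
𝒜-cons s ys (1+s≤n , (Σ≡ , j) , h₁ , h₂) =
  (sum-∷⁺ (suc s) ys 1+s≤n Σ≡ , Jagged-suc∷⁺ s ys j (Head≤-mono ys (ℕ.n≤1+n (suc s)) h₁ , h₂)) ,
  ℕ.≤-refl , h₁

ℬ-tail : ∀ s {n} ys → ℬ s n (s ∷ suc s ∷ ys) → Shifted (s + suc s) (ℬ s) n ys
ℬ-tail s ys ((Σ≡n , j) , _) =
  proj₁ tail-sum , (proj₂ tail-sum , proj₁ jagged₂) , proj₂ (proj₂ jagged₁) , proj₂ (proj₂ jagged₂)
  where
  tail-sum = sum-∷⁻ (s + suc s) ys (trans (ℕ.+-assoc s (suc s) (sum ys)) Σ≡n)
  jagged₁ = Jagged-∷⁻ s (suc s ∷ ys) j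
  jagged₂ = Jagged-∷⁻ (suc s) ys (proj₁ jagged₁)

ℬ-cons : ∀ s {n} ys → Shifted (s + suc s) (ℬ s) n ys → ℬ s n (s ∷ suc s ∷ ys)
ℬ-cons s ys (le , (Σ≡ , j) , h₁ , h₂) = (Σ≡n , jagged) , ℕ.≤-refl , ℕ.≤-refl
  where
  Σ≡n = trans (sym (ℕ.+-assoc s (suc s) (sum ys))) (sum-∷⁺ (s + suc s) ys le Σ≡)
  jagged = Jagged-∷∷⁺ s (suc s) ys
             (Jagged-suc∷⁺ s ys j (Head≤-mono ys (ℕ.≤-trans (ℕ.n≤1+n s) (ℕ.n≤1+n (suc s))) h₁ , h₂))
             (ℕ.≤-refl , h₁)

𝒜-split : ∀ s {n xs} → 𝒜 (suc s) n xs →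
          ℬ s n xs ⊎ ∃[ ys ] xs ≡ suc s ∷ ys × Shifted (suc s) (𝒜 (suc s)) n ys
𝒜-split s {xs = []}     (p , _)            = inj₁ (p , tt , tt)
𝒜-split s {xs = x ∷ ys} a@(p , x≤1+s , h) with x ≤? s
... | yes x≤s = inj₁ (p , x≤s , h)
... | no  x≰s with ℕ.≤-antisym x≤1+s (ℕ.≰⇒> x≰s)
...   | refl = inj₂ (ys , refl , 𝒜-tail s ys a)

ℬ-split : ∀ s {n xs} → ℬ s n xs →
          𝒜 s n xs ⊎ ∃[ ys ] xs ≡ s ∷ suc s ∷ ys × Shifted (s + suc s) (ℬ s) n ys
ℬ-split s {xs = []}         (p , _)              = inj₁ (p , tt , tt)
ℬ-split s {xs = x ∷ []}     (p , x≤s , _)        = inj₁ (p , x≤s , tt)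
ℬ-split s {xs = x ∷ y ∷ ys} b@(p , x≤s , y≤1+s) with y ≤? s
... | yes y≤s = inj₁ (p , x≤s , y≤s)
... | no  y≰s with ℕ.≤-antisym y≤1+s (ℕ.≰⇒> y≰s)
...   | refl with ℕ.≤-antisym x≤s (ℕ.≤-pred (proj₁ (proj₂ (Jagged-∷⁻ x (y ∷ ys) (proj₂ p)))))
...     | refl = inj₂ (ys , refl , ℬ-tail s ys b)

ℬ-∌ : ∀ s {n} ys → ¬ ℬ s n (suc s ∷ ys)
ℬ-∌ s ys (_ , 1+s≤s , _) = ℕ.1+n≰n 1+s≤s

𝒜-∌ : ∀ s {n} ys → ¬ 𝒜 s n (s ∷ suc s ∷ ys)
𝒜-∌ s ys (_ , _ , 1+s≤s) = ℕ.1+n≰n 1+s≤s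

𝒜₀-enumeration : ∀ n → Enumeration (𝒜 0 n)
𝒜₀-enumeration zero    = enumeration ([] ∷ []) (All.[] ∷ []) complete′ sound′
  where
  complete′ : ∀ xs → 𝒜 0 0 xs → xs ∈ [] ∷ []
  complete′ xs a with 𝒜₀-empty xs a
  ... | refl = here refl
  sound′ : ∀ xs → xs ∈ [] ∷ [] → 𝒜 0 0 xs
  sound′ _ (here refl) = (refl , tt) , tt , tt
𝒜₀-enumeration (suc n) = Enumeration-∅ λ {xs} a →
  ℕ.0≢1+n (trans (cong sum (sym (𝒜₀-empty xs a))) (proj₁ (proj₁ a)))

module 𝒜-Union (s n : ℕ) = DisjointUnion (suc s ∷_) List.∷-injectiveʳ
  (𝒜-split s {n}) (ℬ⇒𝒜 s _) (𝒜-cons s _) (ℬ-∌ s _)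

module ℬ-Union (s n : ℕ) = DisjointUnion (λ ys → s ∷ suc s ∷ ys)
  (List.∷-injectiveʳ ∘ List.∷-injectiveʳ) (ℬ-split s {n}) (𝒜⇒ℬ s _) (ℬ-cons s _) (𝒜-∌ s _)

Enumerations : ℕ → Set
Enumerations n = ∀ s → Enumeration (𝒜 s n) × Enumeration (ℬ s n)

enumerations : ∀ n → Enumerations n
enumerations = <-rec Enumerations step
  where
  step : ∀ n → (∀ {m} → m < n → Enumerations m) → Enumerations n
  step n earlier = go
    where
    tail : ∀ {P} u → 0 < u → (∀ {m} → m < n → Enumeration (P m)) → Enumeration (Shifted u P n)
    tail {P} u 0<u E = shifted u {P} n λ u≤n → E (ℕ.∸-monoʳ-< 0<u u≤n)
    withℬ : ∀ s → Enumeration (𝒜 s n) → Enumeration (𝒜 s n) × Enumeration (ℬ s n)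
    withℬ s E = E , ℬ-Union.union s n E (tail (s + suc s) (ℕ.≤-trans (s≤s z≤n) (ℕ.m≤n+m (suc s) s))
                                                λ m<n → proj₂ (earlier m<n s))
    go : Enumerations n
    go zero    = withℬ 0 (𝒜₀-enumeration n)
    go (suc s) = withℬ (suc s) (𝒜-Union.union s n (proj₂ (go s))
                                  (tail (suc s) (s≤s z≤n) λ m<n → proj₁ (earlier m<n (suc s))))

𝒜-enumeration : ∀ s n → Enumeration (𝒜 s n)
𝒜-enumeration s n = proj₁ (enumerations n s)

ℬ-enumeration : ∀ s n → Enumeration (ℬ s n)
ℬ-enumeration s n = proj₂ (enumerations n s)

A B : ℕ → Series
A s = generating (𝒜-enumeration s)
B s = generating (ℬ-enumeration s)

A-zero : A 0 ≈ 𝟙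
A-zero = coeffwise λ n →
  trans (cong +_ (size-unique (𝒜-enumeration 0 n) (𝒜₀-enumeration n))) (𝒜₀-size n)
  where
  𝒜₀-size : ∀ n → + size (𝒜₀-enumeration n) ≡ 𝟙 n
  𝒜₀-size zero    = refl
  𝒜₀-size (suc n) = refl

A-suc : ∀ s → 1-q^ suc s · A (suc s) ≈ B s
A-suc s = 1-q^-generating (suc s) (𝒜-enumeration (suc s)) (ℬ-enumeration s) λ n →
  𝒜-Union.size-union s n (𝒜-enumeration (suc s) n) (ℬ-enumeration s n)

B-rec : ∀ s → 1-q^ (s + suc s) · B s ≈ A s
B-rec s = 1-q^-generating (s + suc s) (ℬ-enumeration s) (𝒜-enumeration s) λ n →
  ℬ-Union.size-union s n (ℬ-enumeration s n) (𝒜-enumeration s n)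

partitions : ∀ n → Enumeration (Is01Partition n)
partitions n = Enumeration-⇔ proj₁ (𝒜-all n _ ℕ.≤-refl) (𝒜-enumeration n n)

J : Series
J = generating partitions

A-stable : ∀ {s n} → n ≤ s → A s n ≡ J n
A-stable {s} {n} n≤s =
  cong +_ (size-unique (Enumeration-⇔ proj₁ (𝒜-all s _ n≤s) (𝒜-enumeration s n)) (partitions n))

θ-cong-at : ∀ s n {X Y} → (∀ {i} → i ≤ n → X i ≡ Y i) → θ s X n ≡ θ s Y n
θ-cong-at s n {X} {Y} eq =
  ∑±-cong-at s (λ k → θ-term k X) (λ k → θ-term k Y) n λ {k} _ →
    θ-term-cong-at k n λ _ → eq (ℕ.m∸n≤m n (k * k))

θJ≡0 : ∀ n → 1 ≤ n → θ n J n ≡ 0ℤ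
θJ≡0 n@(suc _) _ = begin
  θ n J n          ≡⟨ θ-cong-at n n (sym ∘ A-stable) ⟩
  θ n (A n) n      ≡⟨ Q-low n (A n) ℕ.≤-refl ⟨
  Q n (A n) n      ≡⟨ coeff (Q-inverse A B A-zero A-suc B-rec n) n ⟩
  0ℤ               ∎
  where open ≡-Reasoning

-- Divisibility

∣-∑ : ∀ r F n {d} → (∀ {k} → 1 ≤ k → k ≤ r → d ∣ᶻ F k n) → d ∣ᶻ ∑ r F n
∣-∑ zero    F n d∣ = divides 0ℤ refl
∣-∑ (suc r) F n d∣ =
  ∣m∣n⇒∣m+n (∣-∑ r F n λ 1≤k k≤r → d∣ 1≤k (ℕ.m≤n⇒m≤1+n k≤r)) (d∣ (s≤s z≤n) ℕ.≤-refl)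

jSum : ℕ → ℤ
jSum n = ∑ n (λ k → θ-term k J) n

j-recurrence : ∀ n → 1 ≤ n → J n ≡ -ᶻ (+ 2 *ᶻ jSum n)
j-recurrence n 1≤n = solve-for (J n) _ (θJ≡0 n 1≤n)
  where
  solve-for : ∀ x y → 1ℤ *ᶻ x +ᶻ y ≡ 0ℤ → x ≡ -ᶻ y
  solve-for x y eq = begin
    x                         ≡⟨ isolate x y ⟩
    (1ℤ *ᶻ x +ᶻ y) -ᶻ y       ≡⟨ cong (_-ᶻ y) eq ⟩
    0ℤ -ᶻ y                   ≡⟨ ℤ.+-identityˡ (-ᶻ y) ⟩
    -ᶻ y                      ∎
    where
    open ≡-Reasoning
    isolate : ∀ x y → x ≡ (1ℤ *ᶻ x +ᶻ y) -ᶻ y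
    isolate = ℤ-solve

∣jSum⇒2*∣J : ∀ n {d} → 1 ≤ n → d ∣ᶻ jSum n → + 2 *ᶻ d ∣ᶻ J n
∣jSum⇒2*∣J n 1≤n d∣∑ = subst (_ ∣ᶻ_) (sym (j-recurrence n 1≤n)) (∣m⇒∣-m (*-monoʳ-∣ (+ 2) d∣∑))

sumOfSquares-∷ : ∀ {p n k} → 1 ≤ k → k * k ≤ n →
                 SumOfAtMostSquares p (n ∸ k * k) → SumOfAtMostSquares (suc p) n
sumOfSquares-∷ {k = k} 1≤k k²≤n (xs , length≤p , positive , sum≡) =
  k ∷ xs , s≤s length≤p , 1≤k All.∷ positive , trans (cong (_+_ (k * k)) sum≡) (ℕ.m+[n∸m]≡n k²≤n)

2^[p+1]∣J : ∀ p n → 1 ≤ n → ¬ SumOfAtMostSquares p n → + (2 ^ (p + 1)) ∣ᶻ J n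
2^[p+1]∣J zero    n 1≤n _  = ∣jSum⇒2*∣J n 1≤n (divides (jSum n) (sym (ℤ.*-identityʳ (jSum n))))
2^[p+1]∣J (suc p) n 1≤n ¬sq =
  subst (_∣ᶻ J n) (sym (ℤ.pos-* 2 (2 ^ (p + 1)))) (∣jSum⇒2*∣J n 1≤n (∣-∑ n _ n term))
  where
  d = + (2 ^ (p + 1))
  shiftedTerm : ∀ {k} → 1 ≤ k → d ∣ᶻ (q^ (k * k) · J) n
  shiftedTerm {k} 1≤k with k * k ≤? n
  ... | no  k²≰n = subst (d ∣ᶻ_) (sym (q^-< (k * k) J (ℕ.≰⇒> k²≰n))) (divides 0ℤ refl)
  ... | yes k²≤n = subst (d ∣ᶻ_) (sym (q^-≥ (k * k) J k²≤n)) (remainder (n ∸ k * k) refl)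
    where
    extend : ∀ {m} → n ∸ k * k ≡ m → SumOfAtMostSquares p m → SumOfAtMostSquares (suc p) n
    extend eq sq = sumOfSquares-∷ 1≤k k²≤n (subst (SumOfAtMostSquares p) (sym eq) sq)
    remainder : ∀ m → n ∸ k * k ≡ m → d ∣ᶻ J m
    remainder zero    eq = ⊥-elim (¬sq (extend eq ([] , z≤n , All.[] , refl)))
    remainder (suc m) eq = 2^[p+1]∣J p (suc m) (s≤s z≤n) (¬sq ∘ extend eq)
  term : ∀ {k} → 1 ≤ k → k ≤ n → d ∣ᶻ θ-term k J n
  term {k} 1≤k _ = ∣n⇒∣m*n (-1ℤ ^ᶻ k) (shiftedTerm 1≤k)

corollary8 : (p n : ℕ) → p ≥ 1 → n ≥ 1 → ¬ SumOfAtMostSquares p n →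
    (L : List (List ℕ)) → Unique L → (∀ xs → Is01Partition n xs → xs ∈ L) →
    (∀ xs → xs ∈ L → Is01Partition n xs) →
    2 ^ (p Data.Nat.+ 1) ∣ length L
corollary8 p n _ n≥1 ¬sq L unique complete sound =
  subst (2 ^ (p + 1) ∣_) (size-unique (partitions n) (enumeration L unique complete sound))
        (∣⇒∣ᵤ (2^[p+1]∣J p n n≥1 ¬sq))
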